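{- Every connected and co-connected graph that is both claw-free and gem-free is $W_4$-free.
   Context: All graphs are finite and simple. A graph is co-connected if its complement is connected. The claw is $K_{1,3}$; the gem is $P_4$ plus a vertex adjacent to all its vertices; $W_4$ is the cycle $C_4$ plus a vertex adjacent to all its vertices. "$H$-free" means having no induced subgraph isomorphic to $H$. -}

module Defs where

open import Data.Nat using (ℕ; suc)
open import Data.Fin using (Fin; zero; suc)
open import Data.Bool using (Bool; true; false; T)
open import Data.Product using (Σ; _×_; _,_; ∃)
open import Data.Empty using (⊥)
open import Relation.Nullary using (¬_)
open import Relation.Binary.PropositionalEquality using (_≡_)
open import Function.Definitions using (Injective)
open import Level using (0ℓ)

record Graph (n : ℕ) : Set₁ where
  field
    Adj   : Fin n → Fin n → Set
    irrefl : ∀ i → ¬ Adj i i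
    sym    : ∀ {i j} → Adj i j → Adj j i
open Graph public

complement : ∀ {n} → Graph n → Graph n
complement G = record
  { Adj = λ i j → ¬ (i ≡ j) × ¬ Adj G i j
  ; irrefl = λ { i (i≢i , _) → i≢i Relation.Binary.PropositionalEquality.refl }
  ; sym = λ { (i≢j , ¬a) → (λ e → i≢j (Relation.Binary.PropositionalEquality.sym e))
                         , (λ a → ¬a (Graph.sym G a)) }
  }

data Reach {n : ℕ} (G : Graph n) : Fin n → Fin n → Set where
  here : ∀ {u} → Reach G u u
  step : ∀ {u v w} → Adj G u v → Reach G v w → Reach G u w

-- Connected: every two vertices are joined by a walk.
-- (Whether the null graph counts as connected is irrelevant here:
--  the null graph is trivially W4-free.)
Connected : ∀ {n} → Graph n → Set
Connected G = ∀ u v → Reach G u v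

CoConnected : ∀ {n} → Graph n → Set
CoConnected G = Connected (complement G)

record SmallGraph : Set where
  field
    size : ℕ
    adj  : Fin size → Fin size → Bool
open SmallGraph public

InducedSub : ∀ {n} → SmallGraph → Graph n → Set
InducedSub {n} H G =
  Σ (Fin (size H) → Fin n) λ f →
    Injective _≡_ _≡_ f ×
    (∀ i j → ¬ (i ≡ j) → (Adj G (f i) (f j) → T (adj H i j)) × (T (adj H i j) → Adj G (f i) (f j)))

Free : ∀ {n} → SmallGraph → Graph n → Set
Free H G = ¬ InducedSub H G

clawAdj : Fin 4 → Fin 4 → Bool
clawAdj zero (suc _) = true
clawAdj (suc _) zero = true
clawAdj _ _ = false

claw : SmallGraph
claw = record { size = 4 ; adj = clawAdj }

-- Gem: path 0-1-2-3 plus vertex 4 adjacent to 0,1,2,3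
gemAdj : Fin 5 → Fin 5 → Bool
gemAdj zero (suc zero) = true
gemAdj (suc zero) zero = true
gemAdj (suc zero) (suc (suc zero)) = true
gemAdj (suc (suc zero)) (suc zero) = true
gemAdj (suc (suc zero)) (suc (suc (suc zero))) = true
gemAdj (suc (suc (suc zero))) (suc (suc zero)) = true
gemAdj (suc (suc (suc (suc zero)))) (suc (suc (suc (suc zero)))) = false
gemAdj (suc (suc (suc (suc zero)))) _ = true
gemAdj _ (suc (suc (suc (suc zero)))) = true
gemAdj _ _ = false

gem : SmallGraph
gem = record { size = 5 ; adj = gemAdj }

-- W_4: cycle 0-1-2-3-0 plus hub 4 adjacent to 0,1,2,3
w4Adj : Fin 5 → Fin 5 → Bool
w4Adj zero (suc zero) = true
w4Adj (suc zero) zero = true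
w4Adj (suc zero) (suc (suc zero)) = true
w4Adj (suc (suc zero)) (suc zero) = true
w4Adj (suc (suc zero)) (suc (suc (suc zero))) = true
w4Adj (suc (suc (suc zero))) (suc (suc zero)) = true
w4Adj (suc (suc (suc zero))) zero = true
w4Adj zero (suc (suc (suc zero))) = true
w4Adj (suc (suc (suc (suc zero)))) (suc (suc (suc (suc zero)))) = false
w4Adj (suc (suc (suc (suc zero)))) _ = true
w4Adj _ (suc (suc (suc (suc zero)))) = true
w4Adj _ _ = false

W4 : SmallGraph
W4 = record { size = 5 ; adj = w4Adj }

-- Let h be the hub of an induced W₄ on the square a b c d. Claw- and gem-freeness give two
-- local facts: a non-neighbour of a vertex dominating the square that sees one vertex of the
-- square sees all of them, and a neighbour of a vertex that misses the square misses it too.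
-- By connectivity the second fact shows that every vertex sees the square; by the first, every
-- vertex on a walk in the complement from h to a dominates the square, which fails for a itself.
module Submission where

open import Data.Nat using (ℕ)
open import Data.Fin using (Fin; _≟_)
open import Data.Fin.Patterns using (0F; 1F; 2F; 3F; 4F)
open import Data.Bool using (Bool; true; false; T)
open import Data.Unit using (tt)
open import Data.Product using (∃₂; _×_; _,_; proj₁; proj₂)
open import Data.Empty using (⊥-elim)
open import Function using (_∘_)
open import Function.Definitions using (Injective)
open import Relation.Nullary using (¬_; yes; no)
open import Relation.Nullary.Decidable using (¬¬-excluded-middle)
open import Relation.Binary.PropositionalEquality using (_≡_; refl)

open import Defs

module _ {n : ℕ} (G : Graph n) where

  infix 4 _~_ _≁_

  _~_ : Fin n → Fin n → Set
  x ~ y = Adj G x y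

  _≁_ : Fin n → Fin n → Set
  x ≁ y = Adj (complement G) x y

  ~-sym : ∀ {x y} → x ~ y → y ~ x
  ~-sym = Graph.sym G

  ≁-sym : ∀ {x y} → x ≁ y → y ≁ x
  ≁-sym = Graph.sym (complement G)

  ≁-by : ∀ {p x y} → p ~ x → ¬ p ~ y → ¬ x ~ y → x ≁ y
  ≁-by px ¬py ¬xy = (λ { refl → ¬py px }) , ¬xy

  Match : Fin n → Fin n → Bool → Set
  Match x y true  = x ~ y
  Match x y false = x ≁ y

  match-≢ : ∀ {x y} b → Match x y b → ¬ x ≡ y
  match-≢ true  xy refl     = Graph.irrefl G _ xy
  match-≢ false (x≢y , _) = x≢y

  match⇔adj : ∀ {x y} b → Match x y b → (x ~ y → T b) × (T b → x ~ y)
  match⇔adj true  xy        = (λ _ → tt) , (λ _ → xy)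
  match⇔adj false (_ , ¬xy) = ¬xy , λ ()

  induced : (H : SmallGraph) (f : Fin (size H) → Fin n) →
            (∀ i j → ¬ i ≡ j → Match (f i) (f j) (adj H i j)) → InducedSub H G
  induced H f match = f , injective , λ i j i≢j → match⇔adj (adj H i j) (match i j i≢j)
    where
    injective : Injective _≡_ _≡_ f
    injective {i} {j} fi≡fj with i ≟ j
    ... | yes i≡j = i≡j
    ... | no  i≢j = ⊥-elim (match-≢ (adj H i j) (match i j i≢j) fi≡fj)

  claw-at : ∀ {c x y z} → c ~ x → c ~ y → c ~ z → x ≁ y → x ≁ z → y ≁ z →
            InducedSub claw G
  claw-at {c} {x} {y} {z} cx cy cz xy xz yz = induced claw vertex match
    where
    vertex : Fin 4 → Fin n
    vertex 0F = c
    vertex 1F = x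
    vertex 2F = y
    vertex 3F = z

    match : ∀ i j → ¬ i ≡ j → Match (vertex i) (vertex j) (clawAdj i j)
    match 0F 1F _ = cx
    match 0F 2F _ = cy
    match 0F 3F _ = cz
    match 1F 2F _ = xy
    match 1F 3F _ = xz
    match 2F 3F _ = yz
    match 1F 0F _ = ~-sym cx
    match 2F 0F _ = ~-sym cy
    match 3F 0F _ = ~-sym cz
    match 2F 1F _ = ≁-sym xy
    match 3F 1F _ = ≁-sym xz
    match 3F 2F _ = ≁-sym yz
    match 0F 0F i≢i = ⊥-elim (i≢i refl)
    match 1F 1F i≢i = ⊥-elim (i≢i refl)
    match 2F 2F i≢i = ⊥-elim (i≢i refl)
    match 3F 3F i≢i = ⊥-elim (i≢i refl)

  gem-on : ∀ {p₀ p₁ p₂ p₃ q} → p₀ ~ p₁ → p₁ ~ p₂ → p₂ ~ p₃ →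
           q ~ p₀ → q ~ p₁ → q ~ p₂ → q ~ p₃ → p₀ ≁ p₂ → p₀ ≁ p₃ → p₁ ≁ p₃ →
           InducedSub gem G
  gem-on {p₀} {p₁} {p₂} {p₃} {q} e₀₁ e₁₂ e₂₃ q₀ q₁ q₂ q₃ n₀₂ n₀₃ n₁₃ =
    induced gem vertex match
    where
    vertex : Fin 5 → Fin n
    vertex 0F = p₀
    vertex 1F = p₁
    vertex 2F = p₂
    vertex 3F = p₃
    vertex 4F = q

    match : ∀ i j → ¬ i ≡ j → Match (vertex i) (vertex j) (gemAdj i j)
    match 0F 1F _ = e₀₁
    match 0F 2F _ = n₀₂
    match 0F 3F _ = n₀₃
    match 1F 2F _ = e₁₂
    match 1F 3F _ = n₁₃
    match 2F 3F _ = e₂₃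
    match 4F 0F _ = q₀
    match 4F 1F _ = q₁
    match 4F 2F _ = q₂
    match 4F 3F _ = q₃
    match 1F 0F _ = ~-sym e₀₁
    match 2F 0F _ = ≁-sym n₀₂
    match 3F 0F _ = ≁-sym n₀₃
    match 2F 1F _ = ~-sym e₁₂
    match 3F 1F _ = ≁-sym n₁₃
    match 3F 2F _ = ~-sym e₂₃
    match 0F 4F _ = ~-sym q₀
    match 1F 4F _ = ~-sym q₁
    match 2F 4F _ = ~-sym q₂
    match 3F 4F _ = ~-sym q₃
    match 0F 0F i≢i = ⊥-elim (i≢i refl)
    match 1F 1F i≢i = ⊥-elim (i≢i refl)
    match 2F 2F i≢i = ⊥-elim (i≢i refl)
    match 3F 3F i≢i = ⊥-elim (i≢i refl)
    match 4F 4F i≢i = ⊥-elim (i≢i refl)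

  record Square : Set where
    field
      a b c d : Fin n
      ab : a ~ b
      bc : b ~ c
      cd : c ~ d
      da : d ~ a
      ac : a ≁ c
      bd : b ≁ d

  open Square

  rotate : Square → Square
  rotate S = record
    { a = b S ; b = c S ; c = d S ; d = a S
    ; ab = bc S ; bc = cd S ; cd = da S ; da = ab S
    ; ac = bd S ; bd = ≁-sym (ac S) }

  reflect : Square → Square
  reflect S = record
    { a = a S ; b = d S ; c = c S ; d = b S
    ; ab = ~-sym (da S) ; bc = ~-sym (cd S) ; cd = ~-sym (bc S) ; da = ~-sym (ab S)
    ; ac = ac S ; bd = ≁-sym (bd S) }

  record AllRim (P : Fin n → Set) (S : Square) : Set where
    constructor rim
    field
      at-a : P (a S)
      at-b : P (b S)
      at-c : P (c S)
      at-d : P (d S)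

  open AllRim

  rotate-all : ∀ {P S} → AllRim P S → AllRim P (rotate S)
  rotate-all (rim pa pb pc pd) = rim pb pc pd pa

  unrotate-all : ∀ {P S} → AllRim P (rotate S) → AllRim P S
  unrotate-all (rim pb pc pd pa) = rim pa pb pc pd

  reflect-all : ∀ {P S} → AllRim P S → AllRim P (reflect S)
  reflect-all (rim pa pb pc pd) = rim pa pd pc pb

  Dominates : Fin n → Square → Set
  Dominates w = AllRim (w ~_)

  Misses : Fin n → Square → Set
  Misses w = AllRim (λ x → ¬ w ~ x)

  W4⇒dominated-square : InducedSub W4 G → ∃₂ λ S h → Dominates h S
  W4⇒dominated-square (f , injective , adj⇔) =
    square , f 4F ,
    rim (edge 4F 0F (λ ())) (edge 4F 1F (λ ())) (edge 4F 2F (λ ())) (edge 4F 3F (λ ()))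
    where
    edge : ∀ i j → ¬ i ≡ j → {T (w4Adj i j)} → f i ~ f j
    edge i j i≢j {ij} = proj₂ (adj⇔ i j i≢j) ij

    non-edge : ∀ i j → ¬ i ≡ j → ¬ T (w4Adj i j) → f i ≁ f j
    non-edge i j i≢j ¬ij = i≢j ∘ injective , ¬ij ∘ proj₁ (adj⇔ i j i≢j)

    square : Square
    square = record
      { a = f 0F ; b = f 1F ; c = f 2F ; d = f 3F
      ; ab = edge 0F 1F (λ ()) ; bc = edge 1F 2F (λ ())
      ; cd = edge 2F 3F (λ ()) ; da = edge 3F 0F (λ ())
      ; ac = non-edge 0F 2F (λ ()) (λ ()) ; bd = non-edge 1F 3F (λ ()) (λ ()) }

  misses⇒≁ : ∀ S {z} → Misses z S → AllRim (_≁ z) S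
  misses⇒≁ S (rim ¬za ¬zb ¬zc ¬zd) = rim
    (≁-by (~-sym (ab S)) (¬zb ∘ ~-sym) (¬za ∘ ~-sym))
    (≁-by (~-sym (bc S)) (¬zc ∘ ~-sym) (¬zb ∘ ~-sym))
    (≁-by (~-sym (cd S)) (¬zd ∘ ~-sym) (¬zc ∘ ~-sym))
    (≁-by (~-sym (da S)) (¬za ∘ ~-sym) (¬zd ∘ ~-sym))

  module _ (claw-free : Free claw G) (gem-free : Free gem G) where

    -- Adjacency need not be decidable, but every goal below is a negation, so we may case on it.
    -- If w ~ d, then w d h b is a P₄ dominated by a; otherwise a is the centre of the claw a b d w.
    non-neighbour-of-hub-sees-next : ∀ S {h w} → Dominates h S → ¬ h ~ w → w ~ a S → ¬ ¬ w ~ b S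
    non-neighbour-of-hub-sees-next S {h} {w} hub ¬hw wa ¬wb = ¬¬-excluded-middle λ
      { (yes wd) → gem-free (gem-on wd (~-sym (at-d hub)) (at-b hub)
                                   (~-sym wa) (~-sym (da S)) (~-sym (at-a hub)) (ab S)
                                   w≁h (≁-sym b≁w) (≁-sym (bd S)))
      ; (no ¬wd) → claw-free (claw-at (ab S) (~-sym (da S)) (~-sym wa)
                                      (bd S) b≁w (≁-by (at-d hub) ¬hw (¬wd ∘ ~-sym)))
      }
      where
      b≁w : b S ≁ w
      b≁w = ≁-by (at-b hub) ¬hw (¬wb ∘ ~-sym)
      w≁h : w ≁ h
      w≁h = ≁-sym (≁-by (~-sym (at-b hub)) (¬wb ∘ ~-sym) ¬hw)

    non-neighbour-of-hub-seeing-a-dominates : ∀ S {h w} → Dominates h S → ¬ h ~ w → w ~ a S →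
                                              ¬ ¬ Dominates w S
    non-neighbour-of-hub-seeing-a-dominates S hub ¬hw wa ¬dom =
      non-neighbour-of-hub-sees-next S hub ¬hw wa λ wb →
      non-neighbour-of-hub-sees-next (rotate S) (rotate-all hub) ¬hw wb λ wc →
      non-neighbour-of-hub-sees-next (rotate (rotate S)) (rotate-all (rotate-all hub)) ¬hw wc λ wd →
      ¬dom (rim wa wb wc wd)

    non-neighbour-of-hub-dominates : ∀ S {h w} → Dominates h S → ¬ h ~ w → ¬ Misses w S →
                                     ¬ ¬ Dominates w S
    non-neighbour-of-hub-dominates S {h} {w} hub ¬hw ¬misses ¬dom = ¬misses (rim
      (λ wa → seeing-a S hub wa ¬dom)
      (λ wb → seeing-a (rotate S) (rotate-all hub) wb (¬dom ∘ unrotate-all))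
      (λ wc → seeing-a (rotate (rotate S)) (rotate-all (rotate-all hub)) wc
                       (¬dom ∘ unrotate-all ∘ unrotate-all))
      (λ wd → seeing-a (rotate (rotate (rotate S))) (rotate-all (rotate-all (rotate-all hub))) wd
                       (¬dom ∘ unrotate-all ∘ unrotate-all ∘ unrotate-all)))
      where
      seeing-a : ∀ S′ → Dominates h S′ → w ~ a S′ → ¬ ¬ Dominates w S′
      seeing-a S′ hub′ = non-neighbour-of-hub-seeing-a-dominates S′ hub′ ¬hw

    -- If u ~ d, then u is the centre of the claw u b d z; otherwise u b c d is a P₄ dominated by h.
    hub-neighbour-avoids-b : ∀ S {h z u} → Dominates h S → Misses z S → z ~ u → h ~ u →
                             ¬ u ~ c S → ¬ u ~ b S
    hub-neighbour-avoids-b S {z = z} hub m zu hu ¬uc ub = ¬¬-excluded-middle λ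
      { (yes ud) → claw-free (claw-at ub ud (~-sym zu) (bd S) (at-b z≁rim) (at-d z≁rim))
      ; (no ¬ud) → gem-free (gem-on ub (bc S) (cd S) hu (at-b hub) (at-c hub) (at-d hub)
                                   (≁-by zu (at-c m) ¬uc) (≁-by zu (at-d m) ¬ud) (bd S))
      }
      where
      z≁rim : AllRim (_≁ z) S
      z≁rim = misses⇒≁ S m

    -- u ~ c gives the claw u a c z. Otherwise u is a neighbour of h, since a non-neighbour would
    -- see c; then, by the previous lemma and its reflection, h b d u is a claw.
    neighbour-of-missing-avoids-a : ∀ S {h z u} → Dominates h S → Misses z S → z ~ u → ¬ u ~ a S
    neighbour-of-missing-avoids-a S {z = z} hub m zu ua = ¬¬-excluded-middle λ
      { (yes uc) → claw-free (claw-at ua uc (~-sym zu) (ac S) (at-a z≁rim) (at-c z≁rim))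
      ; (no ¬uc) → ¬¬-excluded-middle λ
        { (no ¬hu) → non-neighbour-of-hub-seeing-a-dominates S hub ¬hu ua (¬uc ∘ at-c)
        ; (yes hu) → claw-free (claw-at (at-b hub) (at-d hub) hu (bd S)
            (≁-sym (≁-by zu (at-b m) (hub-neighbour-avoids-b S hub m zu hu ¬uc)))
            (≁-sym (≁-by zu (at-d m)
              (hub-neighbour-avoids-b (reflect S) (reflect-all hub) (reflect-all m) zu hu ¬uc))))
        }
      }
      where
      z≁rim : AllRim (_≁ z) S
      z≁rim = misses⇒≁ S m

    neighbour-of-missing-misses : ∀ S {h z u} → Dominates h S → Misses z S → z ~ u → Misses u S
    neighbour-of-missing-misses S {h} {z} {u} hub m zu = rim
      (avoids-a S hub m)
      (avoids-a (rotate S) (rotate-all hub) (rotate-all m))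
      (avoids-a (rotate (rotate S)) (rotate-all (rotate-all hub)) (rotate-all (rotate-all m)))
      (avoids-a (rotate (rotate (rotate S))) (rotate-all (rotate-all (rotate-all hub)))
                (rotate-all (rotate-all (rotate-all m))))
      where
      avoids-a : ∀ S′ → Dominates h S′ → Misses z S′ → ¬ u ~ a S′
      avoids-a S′ hub′ m′ = neighbour-of-missing-avoids-a S′ hub′ m′ zu

    misses-along : ∀ S {h z t} → Dominates h S → Misses z S → Reach G z t → Misses t S
    misses-along S hub m here        = m
    misses-along S hub m (step zu r) = misses-along S hub (neighbour-of-missing-misses S hub m zu) r

    module _ (connected : Connected G) where

      no-vertex-misses : ∀ S {h} → Dominates h S → ∀ w → ¬ Misses w S
      no-vertex-misses S hub w m = at-b (misses-along S hub m (connected w (a S))) (ab S)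

      dominates-along : ∀ S {v t} → Dominates v S → Reach (complement G) v t → ¬ ¬ Dominates t S
      dominates-along S dom here              ¬dom = ¬dom dom
      dominates-along S dom (step (_ , ¬vw) r) ¬dom =
        non-neighbour-of-hub-dominates S dom ¬vw (no-vertex-misses S dom _) λ dom′ →
        dominates-along S dom′ r ¬dom

      no-dominated-square : CoConnected G → ∀ S h → ¬ Dominates h S
      no-dominated-square coconnected S h hub =
        dominates-along S hub (coconnected h (a S)) λ dom-a → Graph.irrefl G (a S) (at-a dom-a)

lemma8 : ∀ {n} (G : Graph n) → Connected G → CoConnected G →
    Free claw G → Free gem G → Free W4 G
lemma8 G connected coconnected claw-free gem-free W4⊆G =
  let (S , h , hub) = W4⇒dominated-square G W4⊆G
  in no-dominated-square G claw-free gem-free connected coconnected S h hub
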